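{- Let $\alpha\in PP_n$ and let $\rho=(r_1,\dots,r_n),\rho'=(r'_1,\dots,r'_n)\in[0,n]^n$ satisfy $r_i\le r'_i$ for all $i\in[n]$. If $(\alpha,\rho)\in PR_n$, then $(\alpha,\rho')\in PR_n$.
   Context: $[n]=\{1,\dots,n\}$, $[0,n]=\{0,1,\dots,n\}$, $PP_n=[n]^n$. For $r\ge1$, the $r$-Naples parking rule for a car with preference $a$: drive to spot $a$ and park there if free; otherwise check spots $a-1,\dots,a-r$ (only those $\ge1$) in order and park in the first free one; otherwise drive forward to the first free spot $>a$, failing if none. The $0$-Naples rule is the standard rule (park at $a$ or the first free spot after $a$, failing if none). Given $\alpha=(a_1,\dots,a_n)\in PP_n$ and $\rho=(r_1,\dots,r_n)\in[0,n]^n$, cars $c_1,\dots,c_n$ arrive in order at a street with spots $1,\dots,n$, car $c_i$ having preference $a_i$ and following the $r_i$-Naples rule. $PR_n$ is the set of pairs $(\alpha,\rho)$ for which all cars park; then $\rho$ is called a parking strategy for $\alpha$. -}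

module Defs where

open import Data.Nat using (ℕ; zero; suc; _≤_; _<_; _≟_; _≤?_)
open import Data.Bool using (Bool; true; false; if_then_else_)
open import Data.Fin using (Fin; toℕ)
open import Data.Vec using (Vec; []; _∷_; toList)
import Data.Vec as V
open import Data.Maybe using (Maybe; just; nothing; _>>=_; Is-just)
open import Data.List using (List; []; _∷_; _++_; downFrom; upTo; map; filter; head)
open import Relation.Nullary.Decidable using (does)
open import Data.Product using (_×_; _,_)
open import Data.Nat using (_<?_)

-- A street configuration: occ s = true iff spot s is occupied.
-- Spots are the naturals 1..n (spot 0 and spots > n never exist).
Street : Set
Street = ℕ → Bool

emptyStreet : Street
emptyStreet _ = false

occupy : ℕ → Street → Street
occupy s occ t = if does (t ≟ s) then true else occ t

firstFree : Street → List ℕ → Maybe ℕ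
firstFree occ []       = nothing
firstFree occ (s ∷ ss) = if occ s then firstFree occ ss else just s

backList : ℕ → ℕ → List ℕ
backList a zero    = []
backList zero (suc r) = []
backList (suc zero) (suc r) = []
backList (suc (suc a)) (suc r) = suc a ∷ backList (suc a) r

forwardList : ℕ → ℕ → List ℕ
forwardList n a = filter (λ s → a <? s) (map suc (upTo n))

-- Spots inspected, in order, by a car with preference a (1 ≤ a ≤ n)
-- following the r-Naples rule (r = 0 is the standard rule):
-- a, then a-1, ..., a-r (those ≥ 1), then a+1, ..., n.
nearList : ℕ → ℕ → ℕ → List ℕ
nearList n a r = a ∷ (backList a r ++ forwardList n a)

parkSpot : ℕ → Street → ℕ → ℕ → Maybe ℕ
parkSpot n occ a r = firstFree occ (nearList n a r)

runCars : ℕ → Street → List (ℕ × ℕ) → Maybe Street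
runCars n occ []             = just occ
runCars n occ ((a , r) ∷ cs) = parkSpot n occ a r >>= λ s → runCars n (occupy s occ) cs

-- PP_n = [n]^n : preference a_i ∈ [n] encoded as i : Fin n meaning spot toℕ i + 1.
PP : ℕ → Set
PP n = Vec (Fin n) n

-- [0,n]^n : r_i ∈ [0,n] encoded as Fin (suc n) via toℕ.
Strat : ℕ → Set
Strat n = Vec (Fin (suc n)) n

prefVal : ∀ {n} → Fin n → ℕ
prefVal i = suc (toℕ i)

cars : ∀ {n} → PP n → Strat n → List (ℕ × ℕ)
cars α ρ = toList (V.zipWith (λ a r → prefVal a , toℕ r) α ρ)

InPR : ∀ n → PP n → Strat n → Set
InPR n α ρ = Is-just (runCars n emptyStreet (cars α ρ))

_≤ₛ_ : ∀ {n} → Strat n → Strat n → Set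
ρ ≤ₛ ρ' = ∀ i → toℕ (V.lookup ρ i) ≤ toℕ (V.lookup ρ' i)

-- Run both strategies side by side and compare, on every final segment
-- k, …, n of the street, the numbers of parked cars.  Invariant: the laxer run
-- never has more.  When the strict car parks at p and the lax one at p′, the
-- invariant can only break on segments starting in p + 1, …, p′, and there the
-- lax run already had strictly fewer cars: either the lax car drove forward
-- past the full spots p, …, p′ - 1 while p was free in the strict run, or it
-- parked at or behind its preference and the strict car had backed past the
-- full spots p + 1, …, p′ while p′ was free in the lax run.  If the lax car
-- fails, every spot from p on is full in the lax run while p is free in the
-- strict one, contradicting the invariant.
module Submission where

open import Defs
open import Data.Nat using (ℕ; zero; suc; _+_; _≤_; _<_; _>_; _≟_; _≤?_; _<?_; z≤n; s≤s)
open import Data.Nat.Properties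
open import Data.Bool using (true; false; if_then_else_)
open import Data.Fin using (Fin; toℕ)
import Data.Fin as Fin
open import Data.Fin.Properties using (toℕ<n)
open import Data.Vec using (Vec; []; _∷_; toList; lookup; zipWith)
open import Data.Maybe using (just; nothing; _<∣>_; Is-just)
open import Data.Maybe.Relation.Unary.Any using (just)
open import Data.List using ([]; _∷_; _++_; upTo; map)
open import Data.List.Membership.Propositional using (_∈_)
open import Data.List.Membership.Propositional.Properties
open import Data.List.Relation.Unary.Any using (here; there)
import Data.List.Relation.Unary.All as All
open import Data.List.Relation.Unary.AllPairs using (AllPairs; []; _∷_)
import Data.List.Relation.Unary.AllPairs.Properties as AllPairs
open import Data.List.Relation.Binary.Pointwise using (Pointwise; []; _∷_)
open import Data.Product using (_×_; _,_)
open import Data.Sum using (inj₁; inj₂)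
open import Data.Empty using (⊥-elim)
open import Data.Unit using (tt)
open import Function using (id)
open import Relation.Binary.Definitions using (Asymmetric; tri<; tri≈; tri>)
open import Relation.Binary.PropositionalEquality
open import Relation.Nullary using (¬_; yes; no; contradiction)
open import Relation.Nullary.Decidable using (dec-true; dec-false)

Occupied : Street → ℕ → Set
Occupied S t = S t ≡ true

Free : Street → ℕ → Set
Free S t = S t ≡ false

firstFree-++ : ∀ S xs ys → firstFree S (xs ++ ys) ≡ (firstFree S xs <∣> firstFree S ys)
firstFree-++ S []       ys = refl
firstFree-++ S (x ∷ xs) ys with S x
... | true  = firstFree-++ S xs ys
... | false = refl

firstFree-nothing : ∀ {S xs} → firstFree S xs ≡ nothing → ∀ {t} → t ∈ xs → Occupied S t
firstFree-nothing {S} {x ∷ xs} none t∈ with S x in Sx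
firstFree-nothing {S} {x ∷ xs} () _            | false
firstFree-nothing {S} {x ∷ xs} none (here refl) | true = Sx
firstFree-nothing {S} {x ∷ xs} none (there t∈)  | true = firstFree-nothing none t∈

module _ {R : ℕ → ℕ → Set} (asym : Asymmetric R) where

  firstFree-just : ∀ {S xs p} → AllPairs R xs → firstFree S xs ≡ just p →
                   p ∈ xs × Free S p × (∀ {t} → t ∈ xs → R t p → Occupied S t)
  firstFree-just {S} {x ∷ xs} (x<xs ∷ sorted) found with S x in Sx
  ... | true =
    let p∈xs , Sp , before = firstFree-just sorted found in
    there p∈xs , Sp , λ { (here refl) _ → Sx ; (there t∈) → before t∈ }
  ... | false with refl ← found =
    here refl , Sx , λ { (here refl) Rxx → ⊥-elim (asym Rxx Rxx)
                       ; (there t∈) Rtx → ⊥-elim (asym (All.lookup x<xs t∈) Rtx) }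

∈-backList⁻ : ∀ {a r t} → t ∈ backList a r → 1 ≤ t × t < a × a ≤ t + r
∈-backList⁻ {suc (suc a)} {suc r} (here refl) = s≤s z≤n , ≤-refl , m<m+n (suc a) (s≤s z≤n)
∈-backList⁻ {suc (suc a)} {suc r} {t} (there t∈) =
  let 1≤t , t<a , a≤t+r = ∈-backList⁻ t∈ in
  1≤t , m<n⇒m<1+n t<a , ≤-trans (s≤s a≤t+r) (≤-reflexive (sym (+-suc t r)))

∈-backList⁺ : ∀ {a r t} → 1 ≤ t → t < a → a ≤ t + r → t ∈ backList a r
∈-backList⁺ {a} {zero} {t} _ t<a a≤t+r =
  contradiction (≤-trans a≤t+r (≤-reflexive (+-identityʳ t))) (<⇒≱ t<a)
∈-backList⁺ {suc zero} {suc r} (s≤s z≤n) (s≤s ()) _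
∈-backList⁺ {suc (suc a)} {suc r} {t} 1≤t (s≤s t≤1+a) a≤t+r with m≤n⇒m<n∨m≡n t≤1+a
... | inj₂ refl = here refl
... | inj₁ t<1+a = there (∈-backList⁺ 1≤t t<1+a (≤-pred (≤-trans a≤t+r (≤-reflexive (+-suc t r)))))

backList-descending : ∀ {a r} → AllPairs _>_ (backList a r)
backList-descending {a}           {zero}  = []
backList-descending {zero}        {suc r} = []
backList-descending {suc zero}    {suc r} = []
backList-descending {suc (suc a)} {suc r} =
  All.tabulate (λ t∈ → let _ , t<a , _ = ∈-backList⁻ t∈ in t<a) ∷ backList-descending

∈-forwardList⁻ : ∀ {n a t} → t ∈ forwardList n a → a < t × t ≤ n
∈-forwardList⁻ {n} {a} t∈ with t∈′ , a<t ← ∈-filter⁻ (a <?_) {xs = map suc (upTo n)} t∈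
  with u , u∈ , refl ← ∈-map⁻ suc t∈′ = a<t , ∈-upTo⁻ u∈

∈-forwardList⁺ : ∀ {n a t} → a < t → t ≤ n → t ∈ forwardList n a
∈-forwardList⁺ {n} {a} {suc u} a<t t≤n = ∈-filter⁺ (a <?_) (∈-map⁺ suc (∈-upTo⁺ t≤n)) a<t

forwardList-ascending : ∀ {n a} → AllPairs _<_ (forwardList n a)
forwardList-ascending {n} {a} =
  AllPairs.filter⁺ (a <?_) (AllPairs.map⁺ (AllPairs.applyUpTo⁺₁ id n (λ i<j _ → s≤s i<j)))

reach⊆nearList : ∀ {n a r t} → 1 ≤ t → t ≤ n → a ≤ t + r → t ∈ nearList n a r
reach⊆nearList {n} {a} {r} {t} 1≤t t≤n a≤t+r with <-cmp t a
... | tri< t<a _ _ = there (∈-++⁺ˡ (∈-backList⁺ 1≤t t<a a≤t+r))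
... | tri≈ _ refl _ = here refl
... | tri> _ _ a<t = there (∈-++⁺ʳ (backList a r) (∈-forwardList⁺ a<t t≤n))

record ParksAt (n : ℕ) (S : Street) (a r p : ℕ) : Set where
  field
    free           : Free S p
    positive       : 1 ≤ p
    bounded        : p ≤ n
    reachable      : a ≤ p + r
    passedBackward : p < a → ∀ {t} → p < t → t ≤ a → Occupied S t
    passedForward  : a < p → ∀ {t} → 1 ≤ t → a ≤ t + r → t < p → Occupied S t

open ParksAt

Jammed : ℕ → Street → ℕ → ℕ → Set
Jammed n S a r = ∀ {t} → 1 ≤ t → t ≤ n → a ≤ t + r → Occupied S t

module _ {n : ℕ} {S : Street} {a r : ℕ} where

  parksAtPreference : 1 ≤ a → a ≤ n → Free S a → ParksAt n S a r a
  parksAtPreference 1≤a a≤n Sa = record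
    { free = Sa ; positive = 1≤a ; bounded = a≤n ; reachable = m≤m+n a r
    ; passedBackward = λ a<a → contradiction a<a (<-irrefl refl)
    ; passedForward  = λ a<a → contradiction a<a (<-irrefl refl)
    }

  parksBackward : ∀ {p} → a ≤ n → Occupied S a → firstFree S (backList a r) ≡ just p → ParksAt n S a r p
  parksBackward {p} a≤n Sa found
    with p∈back , Sp , before ← firstFree-just <-asym backList-descending found
    with 1≤p , p<a , a≤p+r ← ∈-backList⁻ p∈back = record
    { free = Sp ; positive = 1≤p ; bounded = ≤-trans (<⇒≤ p<a) a≤n ; reachable = a≤p+r
    ; passedBackward = λ _ → passed
    ; passedForward  = λ a<p → contradiction p<a (<-asym a<p)
    }
    where
      passed : ∀ {t} → p < t → t ≤ a → Occupied S t
      passed p<t t≤a with m≤n⇒m<n∨m≡n t≤a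
      ... | inj₂ refl = Sa
      ... | inj₁ t<a  =
        before (∈-backList⁺ (≤-trans 1≤p (<⇒≤ p<t)) t<a (≤-trans a≤p+r (+-monoˡ-≤ r (<⇒≤ p<t)))) p<t

  parksForward : ∀ {p} → Occupied S a → firstFree S (backList a r) ≡ nothing →
                 firstFree S (forwardList n a) ≡ just p → ParksAt n S a r p
  parksForward {p} Sa noneBack found
    with p∈fwd , Sp , before ← firstFree-just <-asym (forwardList-ascending {n} {a}) found
    with a<p , p≤n ← ∈-forwardList⁻ {n} p∈fwd = record
    { free = Sp ; positive = ≤-trans (s≤s z≤n) a<p ; bounded = p≤n
    ; reachable = ≤-trans (<⇒≤ a<p) (m≤m+n p r)
    ; passedBackward = λ p<a → contradiction p<a (<-asym a<p)
    ; passedForward  = λ _ → passed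
    }
    where
      passed : ∀ {t} → 1 ≤ t → a ≤ t + r → t < p → Occupied S t
      passed 1≤t a≤t+r t<p with reach⊆nearList 1≤t (≤-trans (<⇒≤ t<p) p≤n) a≤t+r
      ... | here refl = Sa
      ... | there t∈ with ∈-++⁻ (backList a r) t∈
      ...   | inj₁ t∈back = firstFree-nothing noneBack t∈back
      ...   | inj₂ t∈fwd  = before t∈fwd t<p

  parkSpot-just : ∀ {p} → 1 ≤ a → a ≤ n → parkSpot n S a r ≡ just p → ParksAt n S a r p
  parkSpot-just 1≤a a≤n parked with S a in Sa
  ... | false with refl ← parked = parksAtPreference 1≤a a≤n Sa
  ... | true rewrite firstFree-++ S (backList a r) (forwardList n a) with firstFree S (backList a r) in back
  ...   | just q with refl ← parked = parksBackward a≤n Sa back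
  ...   | nothing = parksForward Sa back parked

  parkSpot-nothing : parkSpot n S a r ≡ nothing → Jammed n S a r
  parkSpot-nothing failed 1≤t t≤n a≤t+r = firstFree-nothing failed (reach⊆nearList 1≤t t≤n a≤t+r)

occupiedIn : Street → ℕ → ℕ → ℕ
occupiedIn S k zero    = 0
occupiedIn S k (suc m) = if S k then suc (occupiedIn S (suc k) m) else occupiedIn S (suc k) m

occupiedIn-+ : ∀ S k d m → occupiedIn S k (d + m) ≡ occupiedIn S k d + occupiedIn S (k + d) m
occupiedIn-+ S k zero    m rewrite +-identityʳ k = refl
occupiedIn-+ S k (suc d) m rewrite +-suc k d with S k
... | true  = cong suc (occupiedIn-+ S (suc k) d m)
... | false = occupiedIn-+ S (suc k) d m

occupiedIn-≤ : ∀ S k m → occupiedIn S k m ≤ m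
occupiedIn-≤ S k zero    = z≤n
occupiedIn-≤ S k (suc m) with S k
... | true  = s≤s (occupiedIn-≤ S (suc k) m)
... | false = m≤n⇒m≤1+n (occupiedIn-≤ S (suc k) m)

occupiedIn-full : ∀ {S k m} → (∀ {t} → k ≤ t → t < k + m → Occupied S t) → occupiedIn S k m ≡ m
occupiedIn-full {S} {k} {zero}  full = refl
occupiedIn-full {S} {k} {suc m} full rewrite full ≤-refl (m<m+n k (s≤s z≤n)) =
  cong suc (occupiedIn-full λ k<t t<k+m → full (<⇒≤ k<t) (≤-trans t<k+m (≤-reflexive (sym (+-suc k m)))))

occupiedIn-free : ∀ {S k m t} → Free S t → k ≤ t → t < k + m → occupiedIn S k m < m
occupiedIn-free {S} {k} {zero} {t} _ k≤t t<k =
  contradiction (≤-trans t<k (≤-reflexive (+-identityʳ k))) (≤⇒≯ k≤t)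
occupiedIn-free {S} {k} {suc m} {t} St k≤t t<k+m with k ≟ t
... | yes refl rewrite St = s≤s (occupiedIn-≤ S (suc k) m)
... | no k≢t with S k
...   | true  = s≤s (occupiedIn-free St (≤∧≢⇒< k≤t k≢t) (≤-trans t<k+m (≤-reflexive (+-suc k m))))
...   | false = m<n⇒m<1+n (occupiedIn-free St (≤∧≢⇒< k≤t k≢t) (≤-trans t<k+m (≤-reflexive (+-suc k m))))

occupy-≡ : ∀ S p → occupy p S p ≡ true
occupy-≡ S p rewrite dec-true (p ≟ p) refl = refl

occupy-≢ : ∀ {S p t} → t ≢ p → occupy p S t ≡ S t
occupy-≢ {S} {p} {t} t≢p rewrite dec-false (t ≟ p) t≢p = refl

occupiedIn-occupy-before : ∀ {S p k} m → p < k → occupiedIn (occupy p S) k m ≡ occupiedIn S k m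
occupiedIn-occupy-before zero    p<k = refl
occupiedIn-occupy-before {S} {p} {k} (suc m) p<k
  rewrite occupy-≢ {S} (>⇒≢ p<k) | occupiedIn-occupy-before {S} m (m<n⇒m<1+n p<k) = refl

occupiedIn-occupy-within : ∀ {S p k m} → Free S p → k ≤ p → p < k + m →
                           occupiedIn (occupy p S) k m ≡ suc (occupiedIn S k m)
occupiedIn-occupy-within {S} {p} {k} {zero} _ k≤p p<k =
  contradiction (≤-trans p<k (≤-reflexive (+-identityʳ k))) (≤⇒≯ k≤p)
occupiedIn-occupy-within {S} {p} {k} {suc m} Sp k≤p p<k+m with k ≟ p
... | yes refl rewrite occupy-≡ S k | Sp = cong suc (occupiedIn-occupy-before m ≤-refl)
... | no k≢p rewrite occupy-≢ {S} k≢p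
                   | occupiedIn-occupy-within {S} {m = m} Sp (≤∧≢⇒< k≤p k≢p)
                       (≤-trans p<k+m (≤-reflexive (+-suc k m)))
  with S k
...   | true  = refl
...   | false = refl

module _ (n : ℕ) where

  infix 4 _≼_

  -- Spots live in 1, …, n, so final segments are the runs of m spots from k with k + m ≡ suc n.
  _≼_ : Street → Street → Set
  S′ ≼ S = ∀ k m → k + m ≡ suc n → occupiedIn S′ k m ≤ occupiedIn S k m

  ≼-refl : ∀ {S} → S ≼ S
  ≼-refl _ _ _ = ≤-refl

  free-then-full⇒fewer : ∀ {S S′ j k m} → S′ ≼ S → j < k → k + m ≡ suc n → Free S j →
                          (∀ {t} → j ≤ t → t < k → Occupied S′ t) →
                          occupiedIn S′ k m < occupiedIn S k m
  free-then-full⇒fewer {S} {S′} {j} {m = m} S′≼S j<k k+m≡ Sj full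
    with e , refl ← m≤n⇒∃[o]m+o≡n (<⇒≤ j<k) = +-cancelˡ-< e _ _ (begin-strict
      e + occupiedIn S′ (j + e) m                   ≡⟨ cong (_+ occupiedIn S′ (j + e) m) (occupiedIn-full full) ⟨
      occupiedIn S′ j e + occupiedIn S′ (j + e) m   ≡⟨ occupiedIn-+ S′ j e m ⟨
      occupiedIn S′ j (e + m)                       ≤⟨ S′≼S j (e + m) (trans (sym (+-assoc j e m)) k+m≡) ⟩
      occupiedIn S j (e + m)                        ≡⟨ occupiedIn-+ S j e m ⟩
      occupiedIn S j e + occupiedIn S (j + e) m     <⟨ +-monoˡ-< _ (occupiedIn-free Sj ≤-refl j<k) ⟩
      e + occupiedIn S (j + e) m                    ∎)
    where open ≤-Reasoning

  full-then-free⇒fewer : ∀ {S S′ k l m t} → S′ ≼ S → k ≤ t → t < l → l ≤ suc n → k + m ≡ suc n →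
                          Free S′ t → (∀ {u} → k ≤ u → u < l → Occupied S u) →
                          occupiedIn S′ k m < occupiedIn S k m
  full-then-free⇒fewer {S} {S′} {k} {m = m} S′≼S k≤t t<l l≤ k+m≡ S′t full
    with d , refl ← m≤n⇒∃[o]m+o≡n (≤-trans k≤t (<⇒≤ t<l))
    with e , k+d+e≡ ← m≤n⇒∃[o]m+o≡n l≤
    with refl ← +-cancelˡ-≡ k m (d + e) (trans k+m≡ (trans (sym k+d+e≡) (+-assoc k d e))) = begin-strict
      occupiedIn S′ k (d + e)                     ≡⟨ occupiedIn-+ S′ k d e ⟩
      occupiedIn S′ k d + occupiedIn S′ (k + d) e <⟨ +-mono-<-≤ (occupiedIn-free S′t k≤t t<l) (S′≼S (k + d) e k+d+e≡) ⟩
      d + occupiedIn S (k + d) e                  ≡⟨ cong (_+ occupiedIn S (k + d) e) (occupiedIn-full full) ⟨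
      occupiedIn S k d + occupiedIn S (k + d) e   ≡⟨ occupiedIn-+ S k d e ⟨
      occupiedIn S k (d + e)                      ∎
    where open ≤-Reasoning

  occupiedIn-occupy-final : ∀ {S q k m} → k + m ≡ suc n → Free S q → k ≤ q → q ≤ n →
                            occupiedIn (occupy q S) k m ≡ suc (occupiedIn S k m)
  occupiedIn-occupy-final k+m≡ Sq k≤q q≤n =
    occupiedIn-occupy-within Sq k≤q (≤-trans (s≤s q≤n) (≤-reflexive (sym k+m≡)))

  occupy-≼ : ∀ {S S′ p p′} → S′ ≼ S → Free S p → Free S′ p′ → p ≤ n → p′ ≤ n →
             (∀ {k m} → k + m ≡ suc n → p < k → k ≤ p′ → occupiedIn S′ k m < occupiedIn S k m) →
             occupy p′ S′ ≼ occupy p S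
  occupy-≼ {S} {S′} {p} {p′} S′≼S Sp S′p′ p≤n p′≤n gap k m k+m≡ with k ≤? p | k ≤? p′
  ... | yes k≤p | yes k≤p′
    rewrite occupiedIn-occupy-final {S} k+m≡ Sp k≤p p≤n | occupiedIn-occupy-final {S′} k+m≡ S′p′ k≤p′ p′≤n =
    s≤s (S′≼S k m k+m≡)
  ... | yes k≤p | no  k≰p′
    rewrite occupiedIn-occupy-final {S} k+m≡ Sp k≤p p≤n | occupiedIn-occupy-before {S′} m (≰⇒> k≰p′) =
    m≤n⇒m≤1+n (S′≼S k m k+m≡)
  ... | no  k≰p | yes k≤p′
    rewrite occupiedIn-occupy-before {S} m (≰⇒> k≰p) | occupiedIn-occupy-final {S′} k+m≡ S′p′ k≤p′ p′≤n =
    gap k+m≡ (≰⇒> k≰p) k≤p′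
  ... | no  k≰p | no  k≰p′
    rewrite occupiedIn-occupy-before {S} m (≰⇒> k≰p) | occupiedIn-occupy-before {S′} m (≰⇒> k≰p′) =
    S′≼S k m k+m≡

  parking-gap : ∀ {S S′ a r r′ p p′} → S′ ≼ S → r ≤ r′ →
                ParksAt n S a r p → ParksAt n S′ a r′ p′ →
                ∀ {k m} → k + m ≡ suc n → p < k → k ≤ p′ → occupiedIn S′ k m < occupiedIn S k m
  parking-gap {a = a} {p′ = p′} S′≼S r≤r′ park park′ k+m≡ p<k k≤p′ with p′ ≤? a
  ... | yes p′≤a =
    full-then-free⇒fewer S′≼S k≤p′ ≤-refl (s≤s (bounded park′)) k+m≡ (free park′)
      λ k≤u u≤p′ → passedBackward park (<-≤-trans p<k (≤-trans k≤p′ p′≤a))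
                     (<-≤-trans p<k k≤u) (≤-trans (≤-pred u≤p′) p′≤a)
  ... | no p′≰a =
    free-then-full⇒fewer S′≼S p<k k+m≡ (free park)
      λ p≤t t<k → passedForward park′ (≰⇒> p′≰a) (≤-trans (positive park) p≤t)
                    (≤-trans (reachable park) (+-mono-≤ p≤t r≤r′)) (<-≤-trans t<k k≤p′)

  parked⇒¬jammed : ∀ {S S′ a r r′ p} → S′ ≼ S → r ≤ r′ → ParksAt n S a r p → ¬ Jammed n S′ a r′
  parked⇒¬jammed S′≼S r≤r′ park jammed = n≮0
    (free-then-full⇒fewer S′≼S (s≤s (bounded park)) (+-identityʳ (suc n)) (free park)
      λ p≤t t<1+n → jammed (≤-trans (positive park) p≤t) (≤-pred t<1+n)
                      (≤-trans (reachable park) (+-mono-≤ p≤t r≤r′)))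

  data Laxer : ℕ × ℕ → ℕ × ℕ → Set where
    laxer : ∀ {a r r′} → 1 ≤ a → a ≤ n → r ≤ r′ → Laxer (a , r) (a , r′)

  runCars-laxer : ∀ {S S′ cs cs′} → S′ ≼ S → Pointwise Laxer cs cs′ →
                  Is-just (runCars n S cs) → Is-just (runCars n S′ cs′)
  runCars-laxer S′≼S [] _ = just tt
  runCars-laxer {S} {S′} S′≼S (laxer {a} {r} {r′} 1≤a a≤n r≤r′ ∷ laxers) parked
    with parkSpot n S a r in spot | parkSpot n S′ a r′ in spot′
  ... | just p | just p′ =
    runCars-laxer (occupy-≼ S′≼S (free park) (free park′) (bounded park) (bounded park′)
                             (parking-gap S′≼S r≤r′ park park′))
                  laxers parked
    where
      park  = parkSpot-just 1≤a a≤n spot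
      park′ = parkSpot-just 1≤a a≤n spot′
  ... | just p | nothing =
    ⊥-elim (parked⇒¬jammed S′≼S r≤r′ (parkSpot-just 1≤a a≤n spot) (parkSpot-nothing spot′))
  runCars-laxer S′≼S (laxer _ _ _ ∷ _) () | nothing | _

  cars-laxer : ∀ {m} (α : Vec (Fin n) m) (ρ ρ′ : Vec (Fin (suc n)) m) →
               (∀ i → toℕ (lookup ρ i) ≤ toℕ (lookup ρ′ i)) →
               Pointwise Laxer (toList (zipWith (λ a r → prefVal a , toℕ r) α ρ))
                               (toList (zipWith (λ a r → prefVal a , toℕ r) α ρ′))
  cars-laxer []      []      []        _     = []
  cars-laxer (a ∷ α) (r ∷ ρ) (r′ ∷ ρ′) ρ≤ρ′ =
    laxer (s≤s z≤n) (toℕ<n a) (ρ≤ρ′ Fin.zero) ∷ cars-laxer α ρ ρ′ (λ i → ρ≤ρ′ (Fin.suc i))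

mainTheorem13 : ∀ (n : ℕ) (α : PP n) (ρ ρ' : Strat n) → ρ ≤ₛ ρ' → InPR n α ρ → InPR n α ρ'
mainTheorem13 n α ρ ρ' ρ≤ρ' = runCars-laxer n (≼-refl n) (cars-laxer n α ρ ρ' ρ≤ρ')
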